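{- Let $\mathcal{D}$ be a Ryser design of Type-2 of order $v$, index $\lambda$ and replication numbers $r_1>r_2$, and let $c,d,a,x,y$ be as in the context. (a) If there exists a block $A$ of size $2\lambda+ta$ with $2tc+\lambda>e_2$, that is $t>x/2$, then $A$ is the unique block of $\mathcal{D}$ whose size is $2\lambda+sa$ for some $s>x/2$. (b) If there exists a block $B$ of size $2\lambda-ta$ with $2td+\lambda>e_1$, that is $t>y/2$, then $B$ is the unique block of $\mathcal{D}$ whose size is $2\lambda-sa$ for some $s>y/2$.
   Context: A Ryser design of order $v$ and index $\lambda$ is a pair $(X,L)$ where $X$ is a set of $v$ points and $L$ is a collection of $v$ subsets (blocks) of $X$ such that any two distinct blocks meet in exactly $\lambda$ points, every block has size $>\lambda$, and there exist two blocks of different sizes. It is known that there are integers $r_1>r_2$ with $r_1+r_2=v+1$ such that every point lies in exactly $r_1$ or exactly $r_2$ blocks. Let $e_i$ be the number of points with replication number $r_i$. Write $(r_1-1)/(r_2-1)=c/d$ with $\gcd(c,d)=1$ and $a=c-d$; every block size has the form $2\lambda+ta$ for an integer $t$. Then $c\mid e_2-\lambda$ and $d\mid e_1-\lambda$; set $x=(e_2-\lambda)/c$, $y=(e_1-\lambda)/d$. A symmetric $(v,k,\mu)$ design is a set of $v$ points with $v$ blocks each of size $k$, any two distinct blocks meeting in $\mu\ge1$ points, $k>\mu$; given such a design with block set $\mathcal{A}$ and a block $A$, the collection $\{A\}\cup\{A\triangle B:B\in\mathcal{A},B\ne A\}$ (when $k\ne 2\mu$) is a Ryser design, and Ryser designs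 obtained this way are of Type-1. A Ryser design is of Type-2 if it is not of Type-1. -}

module Defs where

open import Data.Nat using (ℕ; suc; _+_; _*_; _∸_; _<_; _≟_)
open import Data.Nat.Coprimality using (Coprime)
open import Data.Fin using (Fin)
open import Data.Fin.Subset using (Subset; _∩_; _∪_; _─_; ∣_∣)
open import Data.Fin.Permutation using (Permutation′; _⟨$⟩ʳ_)
open import Data.Vec using (tabulate; lookup)
open import Data.Product using (Σ; ∃; ∃-syntax; _×_; _,_)
open import Relation.Nullary using (¬_; does)
open import Relation.Binary.PropositionalEquality using (_≡_; _≢_)
import Data.Fin as F
open import Data.Bool using (true; false)
open import Data.Sum using (_⊎_)

Blocks : ℕ → Set
Blocks v = Fin v → Subset v

_△_ : ∀ {n} → Subset n → Subset n → Subset n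
A △ B = (A ─ B) ∪ (B ─ A)

record IsRyser (v ℓ : ℕ) (D : Blocks v) : Set where
  field
    inter     : ∀ i j → i ≢ j → ∣ D i ∩ D j ∣ ≡ ℓ
    bigger    : ∀ i → ℓ < ∣ D i ∣
    twoSizes  : ∃[ i ] ∃[ j ] ∣ D i ∣ ≢ ∣ D j ∣

record IsSymmetric (v k μ : ℕ) (S : Blocks v) : Set where
  field
    μ≥1   : 1 Data.Nat.≤ μ
    μ<k   : μ < k
    size  : ∀ i → ∣ S i ∣ ≡ k
    inter : ∀ i j → i ≢ j → ∣ S i ∩ S j ∣ ≡ μ

derived : ∀ {v} → Blocks v → Fin v → Blocks v
derived S a i with does (a F.≟ i)
... | true  = S a
... | false = S a △ S i

-- Type-1: up to a relabelling of blocks (points can be relabelled inside S),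
-- D is the family derived from a symmetric (v,k,μ) design with k ≠ 2μ.
Type1 : (v : ℕ) → Blocks v → Set
Type1 v D = ∃[ k ] ∃[ μ ] Σ (Blocks v) λ S → IsSymmetric v k μ S × k ≢ 2 * μ ×
            Σ (Fin v) λ a → Σ (Permutation′ v) λ π →
              ∀ i → D (π ⟨$⟩ʳ i) ≡ derived S a i

Type2 : (v : ℕ) → Blocks v → Set
Type2 v D = ¬ Type1 v D

rep : ∀ {v} → Blocks v → Fin v → ℕ
rep D p = ∣ tabulate (λ i → lookup (D i) p) ∣

numRep : ∀ {v} → Blocks v → ℕ → ℕ
numRep D r = ∣ tabulate (λ p → does (rep D p ≟ r)) ∣

IsReplicationPair : (v : ℕ) → Blocks v → ℕ → ℕ → Set
IsReplicationPair v D r₁ r₂ =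
  r₂ < r₁ × r₁ + r₂ ≡ suc v × (∀ p → rep D p ≡ r₁ ⊎ rep D p ≡ r₂)

LowestTerms : ℕ → ℕ → ℕ → ℕ → Set
LowestTerms r₁ r₂ c d = Coprime c d × c * (r₂ ∸ 1) ≡ d * (r₁ ∸ 1)

module Submission where

-- For a block A write m₁(A), m₂(A) for the numbers of points of A with
-- replication number r₁, r₂, and e₁, e₂ for the sizes of the two classes.
--   * Counting the incidences (p, B) with p ∈ A ∩ B in two ways gives
--     Σ_{p ∈ A} rep p = ∣A∣ + (v − 1)ℓ.  Splitting A by replication classes
--     and using r₁ + r₂ = v + 1 turns this into the balance equation
--     (r₁ − 1) m₁(A) + (r₂ − 1) m₂(A) = (r₁ − 1 + r₂ − 1) ℓ.
--   * With c(r₂ − 1) = d(r₁ − 1), c ≠ d and ∣A∣ = 2ℓ + t(c − d) the balance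
--     equation forces m₂(A) = ℓ + tc and m₁(A) = ℓ − td.
--   * Two distinct blocks A, A′ share only ℓ points, so
--     m_r(A) + m_r(A′) ≤ e_r + ℓ.  If both were heavy (e₂ < 2tc + ℓ and
--     e₂ < 2sc + ℓ), adding the two bounds would give 2e₂ < 2e₂.

open import Defs
open import Data.Nat using (ℕ)

module Counting where

  open import Data.Nat
  open import Data.Nat.Properties
  open import Data.Nat.Tactic.RingSolver using (solve-∀)
  open import Data.Bool using (Bool; true; false)
  open import Data.Fin using (Fin; zero; suc; punchIn)
  open import Data.Fin.Properties using (punchInᵢ≢i)
  open import Data.Fin.Subset using (Subset; _∩_; ∣_∣)
  open import Data.Vec using ([]; _∷_; lookup; tabulate)
  open import Data.Vec.Properties using (lookup∘tabulate)
  open import Algebra.Properties.Semiring.Sum +-*-semiring public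
    using (sum; sum-syntax; sum-cong-≗; ∑-distrib-+; ∑-comm; *-distribˡ-sum; sum-remove)
  open import Relation.Binary.PropositionalEquality
  open import Relation.Nullary using (does)
  open import Relation.Nullary.Decidable using (dec-true; dec-false)
  open import Data.Sum using (_⊎_; inj₁; inj₂)
  open import Data.Empty using (⊥-elim)
  open import Function using (_∘_)

  χ : Bool → ℕ
  χ true  = 1
  χ false = 0

  ∣S∣≡∑χ : ∀ {n} (S : Subset n) → ∣ S ∣ ≡ ∑[ p < n ] χ (lookup S p)
  ∣S∣≡∑χ []          = refl
  ∣S∣≡∑χ (true ∷ S)  = cong suc (∣S∣≡∑χ S)
  ∣S∣≡∑χ (false ∷ S) = ∣S∣≡∑χ S

  ∣S∩T∣≡∑χχ : ∀ {n} (S T : Subset n) →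
    ∣ S ∩ T ∣ ≡ ∑[ p < n ] (χ (lookup S p) * χ (lookup T p))
  ∣S∩T∣≡∑χχ []          []          = refl
  ∣S∩T∣≡∑χχ (true ∷ S)  (true ∷ T)  = cong suc (∣S∩T∣≡∑χχ S T)
  ∣S∩T∣≡∑χχ (true ∷ S)  (false ∷ T) = ∣S∩T∣≡∑χχ S T
  ∣S∩T∣≡∑χχ (false ∷ S) (_ ∷ T)     = ∣S∩T∣≡∑χχ S T

  ∣tabulate∣≡∑χ : ∀ {n} (f : Fin n → Bool) → ∣ tabulate f ∣ ≡ ∑[ p < n ] χ (f p)
  ∣tabulate∣≡∑χ f = trans (∣S∣≡∑χ (tabulate f)) (sum-cong-≗ (cong χ ∘ lookup∘tabulate f))

  sum-mono-≤ : ∀ {n} {f g : Fin n → ℕ} → (∀ i → f i ≤ g i) → sum f ≤ sum g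
  sum-mono-≤ {zero}  f≤g = z≤n
  sum-mono-≤ {suc n} f≤g = +-mono-≤ (f≤g zero) (sum-mono-≤ (f≤g ∘ suc))

  sum-const : ∀ {n} (f : Fin n → ℕ) k → (∀ i → f i ≡ k) → sum f ≡ n * k
  sum-const {zero}  f k f≡k = refl
  sum-const {suc n} f k f≡k = cong₂ _+_ (f≡k zero) (sum-const (f ∘ suc) k (f≡k ∘ suc))

  sum-except : ∀ {n} (f : Fin n → ℕ) (i : Fin n) k → (∀ j → j ≢ i → f j ≡ k) →
    sum f + k ≡ f i + n * k
  sum-except {suc n} f i k f≡k = begin
    sum f + k                     ≡⟨ cong (_+ k) (sum-remove {i = i} f) ⟩
    f i + sum (f ∘ punchIn i) + k ≡⟨ cong (λ s → f i + s + k) rest ⟩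
    f i + n * k + k               ≡⟨ shuffle (f i) (n * k) k ⟩
    f i + suc n * k               ∎
    where
    open ≡-Reasoning
    rest : sum (f ∘ punchIn i) ≡ n * k
    rest = sum-const (f ∘ punchIn i) k (λ j → f≡k (punchIn i j) (punchInᵢ≢i i j))
    shuffle : ∀ a b k → a + b + k ≡ a + (k + b)
    shuffle = solve-∀

  -- Pointwise form of the next lemma: an element of C lying in both S and T
  -- is counted twice on the left and twice on the right.
  χ-pair-≤ : ∀ s t c → χ s * χ c + χ t * χ c ≤ χ c + χ s * χ t
  χ-pair-≤ true  true  true  = ≤-refl
  χ-pair-≤ true  true  false = z≤n
  χ-pair-≤ true  false true  = ≤-refl
  χ-pair-≤ true  false false = z≤n
  χ-pair-≤ false true  true  = ≤-refl
  χ-pair-≤ false true  false = z≤n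
  χ-pair-≤ false false _     = z≤n

  ∩-pair-≤ : ∀ {n} (S T C : Subset n) → ∣ S ∩ C ∣ + ∣ T ∩ C ∣ ≤ ∣ C ∣ + ∣ S ∩ T ∣
  ∩-pair-≤ {n} S T C = begin
    ∣ S ∩ C ∣ + ∣ T ∩ C ∣
      ≡⟨ cong₂ _+_ (∣S∩T∣≡∑χχ S C) (∣S∩T∣≡∑χχ T C) ⟩
    ∑[ p < n ] (s p * c p) + ∑[ p < n ] (t p * c p)
      ≡⟨ ∑-distrib-+ (λ p → s p * c p) (λ p → t p * c p) ⟨
    ∑[ p < n ] (s p * c p + t p * c p)
      ≤⟨ sum-mono-≤ (λ p → χ-pair-≤ (lookup S p) (lookup T p) (lookup C p)) ⟩
    ∑[ p < n ] (c p + s p * t p)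
      ≡⟨ ∑-distrib-+ c (λ p → s p * t p) ⟩
    ∑[ p < n ] c p + ∑[ p < n ] (s p * t p)
      ≡⟨ cong₂ _+_ (∣S∣≡∑χ C) (∣S∩T∣≡∑χχ S T) ⟨
    ∣ C ∣ + ∣ S ∩ T ∣ ∎
    where
    open ≤-Reasoning
    s t c : Fin n → ℕ
    s p = χ (lookup S p)
    t p = χ (lookup T p)
    c p = χ (lookup C p)

  [_≐_] : ℕ → ℕ → ℕ
  [ x ≐ r ] = χ (does (x ≟ r))

  ≐-refl : ∀ x → [ x ≐ x ] ≡ 1
  ≐-refl x rewrite dec-true (x ≟ x) refl = refl

  ≐-distinct : ∀ {x r} → x ≢ r → [ x ≐ r ] ≡ 0
  ≐-distinct {x} {r} x≢r rewrite dec-false (x ≟ r) x≢r = refl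

  sum-two-values : ∀ {n} (f : ℕ → ℕ) (w h : Fin n → ℕ) {r₁ r₂} → r₁ ≢ r₂ →
    (∀ p → h p ≡ r₁ ⊎ h p ≡ r₂) →
    ∑[ p < n ] (w p * f (h p))
      ≡ f r₁ * ∑[ p < n ] (w p * [ h p ≐ r₁ ]) + f r₂ * ∑[ p < n ] (w p * [ h p ≐ r₂ ])
  sum-two-values {n} f w h {r₁} {r₂} r₁≢r₂ two = begin
    ∑[ p < n ] (w p * f (h p))
      ≡⟨ sum-cong-≗ (λ p → pointwise (w p) (two p)) ⟩
    ∑[ p < n ] (f r₁ * (w p * [ h p ≐ r₁ ]) + f r₂ * (w p * [ h p ≐ r₂ ]))
      ≡⟨ ∑-distrib-+ (λ p → f r₁ * (w p * [ h p ≐ r₁ ])) (λ p → f r₂ * (w p * [ h p ≐ r₂ ])) ⟩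
    ∑[ p < n ] (f r₁ * (w p * [ h p ≐ r₁ ])) + ∑[ p < n ] (f r₂ * (w p * [ h p ≐ r₂ ]))
      ≡⟨ cong₂ _+_ (*-distribˡ-sum (f r₁) (λ p → w p * [ h p ≐ r₁ ]))
                   (*-distribˡ-sum (f r₂) (λ p → w p * [ h p ≐ r₂ ])) ⟨
    f r₁ * ∑[ p < n ] (w p * [ h p ≐ r₁ ]) + f r₂ * ∑[ p < n ] (w p * [ h p ≐ r₂ ]) ∎
    where
    open ≡-Reasoning
    first : ∀ w a b → w * a ≡ a * (w * 1) + b * (w * 0)
    first = solve-∀
    second : ∀ w a b → w * b ≡ a * (w * 0) + b * (w * 1)
    second = solve-∀
    pointwise : ∀ w {x} → x ≡ r₁ ⊎ x ≡ r₂ →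
      w * f x ≡ f r₁ * (w * [ x ≐ r₁ ]) + f r₂ * (w * [ x ≐ r₂ ])
    pointwise w (inj₁ refl) rewrite ≐-refl r₁ | ≐-distinct r₁≢r₂ = first w (f r₁) (f r₂)
    pointwise w (inj₂ refl) rewrite ≐-refl r₂ | ≐-distinct (r₁≢r₂ ∘ sym) = second w (f r₁) (f r₂)

  shift-by-one : ∀ {r₁ r₂ v m₁ m₂ ℓ} → r₁ ≢ 0 → r₂ ≢ 0 → r₁ + r₂ ≡ suc v →
    r₁ * m₁ + r₂ * m₂ + ℓ ≡ m₁ + m₂ + v * ℓ →
    (r₁ ∸ 1) * m₁ + (r₂ ∸ 1) * m₂ ≡ ((r₁ ∸ 1) + (r₂ ∸ 1)) * ℓ
  shift-by-one {zero}                  r₁≢0 _    _ _ = ⊥-elim (r₁≢0 refl)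
  shift-by-one {suc R₁} {zero}         _    r₂≢0 _ _ = ⊥-elim (r₂≢0 refl)
  shift-by-one {suc R₁} {suc R₂} {v} {m₁} {m₂} {ℓ} _ _ r₁+r₂≡1+v weighted =
    +-cancelˡ-≡ (m₁ + m₂ + ℓ) _ _ (begin
      m₁ + m₂ + ℓ + (R₁ * m₁ + R₂ * m₂)   ≡⟨ regroupˡ R₁ R₂ m₁ m₂ ℓ ⟩
      suc R₁ * m₁ + suc R₂ * m₂ + ℓ       ≡⟨ weighted ⟩
      m₁ + m₂ + v * ℓ                     ≡⟨ cong (λ w → m₁ + m₂ + w * ℓ) v≡ ⟩
      m₁ + m₂ + (R₁ + suc R₂) * ℓ         ≡⟨ regroupʳ R₁ R₂ m₁ m₂ ℓ ⟩
      m₁ + m₂ + ℓ + (R₁ + R₂) * ℓ         ∎)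
    where
    open ≡-Reasoning
    v≡ : v ≡ R₁ + suc R₂
    v≡ = sym (suc-injective r₁+r₂≡1+v)
    regroupˡ : ∀ R₁ R₂ m₁ m₂ ℓ → m₁ + m₂ + ℓ + (R₁ * m₁ + R₂ * m₂) ≡ suc R₁ * m₁ + suc R₂ * m₂ + ℓ
    regroupˡ = solve-∀
    regroupʳ : ∀ R₁ R₂ m₁ m₂ ℓ → m₁ + m₂ + (R₁ + suc R₂) * ℓ ≡ m₁ + m₂ + ℓ + (R₁ + R₂) * ℓ
    regroupʳ = solve-∀

module Incidences {v : ℕ} (D : Blocks v) where

  open Counting
  open import Data.Nat
  open import Data.Nat.Properties
  open import Data.Fin using (Fin)
  open import Data.Fin.Subset using (Subset; _∩_; ∣_∣)
  open import Data.Fin.Subset.Properties using (∩-idem)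
  open import Function using (_∘_)
  open import Data.Vec using (lookup; tabulate)
  open import Data.Vec.Properties using (lookup∘tabulate)
  open import Data.Sum using (_⊎_)
  open import Relation.Nullary using (does)
  open import Relation.Binary.PropositionalEquality

  Class : ℕ → Subset v
  Class r = tabulate (λ p → does (rep D p ≟ r))

  classCount : ℕ → Fin v → ℕ
  classCount r A = ∣ D A ∩ Class r ∣

  inc : Fin v → Fin v → ℕ
  inc A p = χ (lookup (D A) p)

  weight : Fin v → ℕ
  weight A = ∑[ p < v ] (inc A p * rep D p)

  -- Double counting the incidences (p, B) with p ∈ A ∩ B.
  weight≡∑∣∩∣ : ∀ A → weight A ≡ ∑[ i < v ] ∣ D A ∩ D i ∣
  weight≡∑∣∩∣ A = begin
    ∑[ p < v ] (inc A p * rep D p)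
      ≡⟨ sum-cong-≗ (λ p → cong (inc A p *_) (∣tabulate∣≡∑χ (λ i → lookup (D i) p))) ⟩
    ∑[ p < v ] (inc A p * ∑[ i < v ] inc i p)
      ≡⟨ sum-cong-≗ (λ p → *-distribˡ-sum (inc A p) (λ i → inc i p)) ⟩
    ∑[ p < v ] ∑[ i < v ] (inc A p * inc i p)
      ≡⟨ ∑-comm (λ p i → inc A p * inc i p) ⟩
    ∑[ i < v ] ∑[ p < v ] (inc A p * inc i p)
      ≡⟨ sum-cong-≗ (λ i → ∣S∩T∣≡∑χχ (D A) (D i)) ⟨
    ∑[ i < v ] ∣ D A ∩ D i ∣ ∎
    where open ≡-Reasoning

  classCount≡∑ : ∀ r A → classCount r A ≡ ∑[ p < v ] (inc A p * [ rep D p ≐ r ])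
  classCount≡∑ r A = trans (∣S∩T∣≡∑χχ (D A) (Class r))
    (sum-cong-≗ (λ p → cong (λ b → inc A p * χ b)
                            (lookup∘tabulate (λ p → does (rep D p ≟ r)) p)))

  module TwoClasses {r₁ r₂ : ℕ} (r₁≢r₂ : r₁ ≢ r₂) (two : ∀ p → rep D p ≡ r₁ ⊎ rep D p ≡ r₂) where

    size-by-class : ∀ A → ∣ D A ∣ ≡ classCount r₁ A + classCount r₂ A
    size-by-class A = begin
      ∣ D A ∣                                   ≡⟨ ∣S∣≡∑χ (D A) ⟩
      ∑[ p < v ] inc A p                        ≡⟨ sum-cong-≗ (λ p → *-identityʳ (inc A p)) ⟨
      ∑[ p < v ] (inc A p * 1)                  ≡⟨ sum-two-values (λ _ → 1) (inc A) (rep D) r₁≢r₂ two ⟩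
      1 * classSum r₁ + 1 * classSum r₂         ≡⟨ cong₂ _+_ (*-identityˡ (classSum r₁)) (*-identityˡ (classSum r₂)) ⟩
      classSum r₁ + classSum r₂                 ≡⟨ cong₂ _+_ (classCount≡∑ r₁ A) (classCount≡∑ r₂ A) ⟨
      classCount r₁ A + classCount r₂ A         ∎
      where
      open ≡-Reasoning
      classSum : ℕ → ℕ
      classSum r = ∑[ p < v ] (inc A p * [ rep D p ≐ r ])

    weight-by-class : ∀ A → weight A ≡ r₁ * classCount r₁ A + r₂ * classCount r₂ A
    weight-by-class A = begin
      weight A
        ≡⟨ sum-two-values (λ x → x) (inc A) (rep D) r₁≢r₂ two ⟩
      r₁ * ∑[ p < v ] (inc A p * [ rep D p ≐ r₁ ]) + r₂ * ∑[ p < v ] (inc A p * [ rep D p ≐ r₂ ])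
        ≡⟨ cong₂ (λ m₁ m₂ → r₁ * m₁ + r₂ * m₂) (classCount≡∑ r₁ A) (classCount≡∑ r₂ A) ⟨
      r₁ * classCount r₁ A + r₂ * classCount r₂ A ∎
      where open ≡-Reasoning

  module _ {ℓ : ℕ} (R : IsRyser v ℓ D) where
    open IsRyser R

    -- In a Ryser design A meets itself in ∣A∣ points and every other block
    -- in ℓ points, so Σ_{p ∈ A} rep p = ∣A∣ + (v − 1)ℓ.
    weight-Ryser : ∀ A → weight A + ℓ ≡ ∣ D A ∣ + v * ℓ
    weight-Ryser A = begin
      weight A + ℓ
        ≡⟨ cong (_+ ℓ) (weight≡∑∣∩∣ A) ⟩
      ∑[ i < v ] ∣ D A ∩ D i ∣ + ℓ
        ≡⟨ sum-except (λ i → ∣ D A ∩ D i ∣) A ℓ (λ i i≢A → inter A i (i≢A ∘ sym)) ⟩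
      ∣ D A ∩ D A ∣ + v * ℓ
        ≡⟨ cong (λ S → ∣ S ∣ + v * ℓ) (∩-idem (D A)) ⟩
      ∣ D A ∣ + v * ℓ ∎
      where open ≡-Reasoning

    -- Two distinct blocks share ℓ points, so together they contain at most
    -- e_r + ℓ points of replication number r.
    classCount-pair-≤ : ∀ r A A′ → A ≢ A′ → classCount r A + classCount r A′ ≤ numRep D r + ℓ
    classCount-pair-≤ r A A′ A≢A′ =
      subst (λ k → classCount r A + classCount r A′ ≤ ∣ Class r ∣ + k)
            (inter A A′ A≢A′) (∩-pair-≤ (D A) (D A′) (Class r))

    module ReplicationPair {r₁ r₂ : ℕ} (r₂<r₁ : r₂ < r₁) (r₁+r₂≡1+v : r₁ + r₂ ≡ suc v)
                           (two : ∀ p → rep D p ≡ r₁ ⊎ rep D p ≡ r₂) where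
      open import Data.Sum using (inj₁; inj₂)
      open import Data.Empty using (⊥-elim)
      open import Data.Fin.Subset.Properties using (∣p∣≤n)

      open TwoClasses (>⇒≢ r₂<r₁) two public

      -- r₂ ≥ 1 as soon as there is a block A: otherwise r₁ = v + 1 exceeds
      -- every replication number, so all points have replication number 0
      -- and weight A + ℓ = ℓ, while weight A + ℓ = ∣A∣ + vℓ > ℓ.
      r₂≢0 : Fin v → r₂ ≢ 0
      r₂≢0 A refl = <-irrefl refl (begin-strict
        ℓ                 <⟨ bigger A ⟩
        ∣ D A ∣           ≤⟨ m≤m+n ∣ D A ∣ (v * ℓ) ⟩
        ∣ D A ∣ + v * ℓ   ≡⟨ weight-Ryser A ⟨
        weight A + ℓ      ≡⟨ cong (_+ ℓ) (sum-const (λ p → inc A p * rep D p) 0 no-incidence) ⟩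
        v * 0 + ℓ         ≡⟨ cong (_+ ℓ) (*-zeroʳ v) ⟩
        ℓ                 ∎)
        where
        open ≤-Reasoning
        r₁≡1+v : r₁ ≡ suc v
        r₁≡1+v = trans (sym (+-identityʳ r₁)) r₁+r₂≡1+v
        rep≡0 : ∀ p → rep D p ≡ 0
        rep≡0 p with two p
        ... | inj₂ rep≡r₂ = rep≡r₂
        ... | inj₁ rep≡r₁ = ⊥-elim (<-irrefl (trans rep≡r₁ r₁≡1+v) (s≤s (∣p∣≤n (tabulate (λ i → lookup (D i) p)))))
        no-incidence : ∀ p → inc A p * rep D p ≡ 0
        no-incidence p = trans (cong (inc A p *_) (rep≡0 p)) (*-zeroʳ (inc A p))

      balance : ∀ A → (r₁ ∸ 1) * classCount r₁ A + (r₂ ∸ 1) * classCount r₂ A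
                      ≡ ((r₁ ∸ 1) + (r₂ ∸ 1)) * ℓ
      balance A = shift-by-one (m<n⇒n≢0 r₂<r₁) (r₂≢0 A) r₁+r₂≡1+v (begin
        r₁ * classCount r₁ A + r₂ * classCount r₂ A + ℓ ≡⟨ cong (_+ ℓ) (weight-by-class A) ⟨
        weight A + ℓ                                    ≡⟨ weight-Ryser A ⟩
        ∣ D A ∣ + v * ℓ                                 ≡⟨ cong (_+ v * ℓ) (size-by-class A) ⟩
        classCount r₁ A + classCount r₂ A + v * ℓ       ∎)
        where open ≡-Reasoning

module IntegerAlgebra where

  open import Data.Integer
  open import Data.Integer.Properties
  open import Data.Integer.Tactic.RingSolver using (solve-∀)
  open import Data.Product using (_×_; _,_)
  open import Data.Sum using (inj₁; inj₂)
  open import Data.Empty using (⊥; ⊥-elim)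
  open import Relation.Binary.PropositionalEquality

  cancel-nonzero : ∀ a {b} → a ≢ 0ℤ → a * b ≡ 0ℤ → b ≡ 0ℤ
  cancel-nonzero a a≢0 ab≡0 with i*j≡0⇒i≡0∨j≡0 a ab≡0
  ... | inj₁ a≡0 = ⊥-elim (a≢0 a≡0)
  ... | inj₂ b≡0 = b≡0

  class-sizes : ∀ (R₁ R₂ c d ℓ m₁ m₂ t : ℤ) → R₁ ≢ 0ℤ → c - d ≢ 0ℤ →
    c * R₂ ≡ d * R₁ → R₁ * m₁ + R₂ * m₂ ≡ (R₁ + R₂) * ℓ →
    m₁ + m₂ ≡ + 2 * ℓ + t * (c - d) →
    m₂ ≡ ℓ + t * c × m₁ ≡ ℓ - t * d
  class-sizes R₁ R₂ c d ℓ m₁ m₂ t R₁≢0 c-d≢0 ratio balanced size =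
    i-j≡0⇒i≡j m₂ (ℓ + t * c) m₂-excess , i-j≡0⇒i≡j m₁ (ℓ - t * d) m₁-excess
    where
    open ≡-Reasoning
    -- Dividing the balance equation by R₁/c: c(m₁ − ℓ) + d(m₂ − ℓ) = 0.
    scaled : c * (m₁ - ℓ) + d * (m₂ - ℓ) ≡ 0ℤ
    scaled = cancel-nonzero R₁ R₁≢0 (begin
      R₁ * (c * (m₁ - ℓ) + d * (m₂ - ℓ))
        ≡⟨ expand R₁ R₂ c d ℓ m₁ m₂ ⟩
      c * (R₁ * m₁ + R₂ * m₂ - (R₁ + R₂) * ℓ) + (d * R₁ - c * R₂) * (m₂ - ℓ)
        ≡⟨ cong₂ (λ x y → c * x + y * (m₂ - ℓ)) (i≡j⇒i-j≡0 balanced) (i≡j⇒i-j≡0 (sym ratio)) ⟩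
      c * 0ℤ + 0ℤ * (m₂ - ℓ)
        ≡⟨ vanish c (m₂ - ℓ) ⟩
      0ℤ ∎)
      where
      expand : ∀ R₁ R₂ c d ℓ m₁ m₂ → R₁ * (c * (m₁ - ℓ) + d * (m₂ - ℓ))
        ≡ c * (R₁ * m₁ + R₂ * m₂ - (R₁ + R₂) * ℓ) + (d * R₁ - c * R₂) * (m₂ - ℓ)
      expand = solve-∀
      vanish : ∀ x y → x * 0ℤ + 0ℤ * y ≡ 0ℤ
      vanish = solve-∀
    -- Eliminating m₁ with the block size: (c − d)(tc − (m₂ − ℓ)) = 0.
    m₂-offset : t * c - (m₂ - ℓ) ≡ 0ℤ
    m₂-offset = cancel-nonzero (c - d) c-d≢0 (begin
      (c - d) * (t * c - (m₂ - ℓ))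
        ≡⟨ expand c d ℓ m₁ m₂ t ⟩
      (c * (m₁ - ℓ) + d * (m₂ - ℓ)) - c * ((m₁ + m₂) - (+ 2 * ℓ + t * (c - d)))
        ≡⟨ cong₂ (λ x y → x - c * y) scaled (i≡j⇒i-j≡0 size) ⟩
      0ℤ - c * 0ℤ
        ≡⟨ vanish c ⟩
      0ℤ ∎)
      where
      expand : ∀ c d ℓ m₁ m₂ t → (c - d) * (t * c - (m₂ - ℓ))
        ≡ (c * (m₁ - ℓ) + d * (m₂ - ℓ)) - c * ((m₁ + m₂) - (+ 2 * ℓ + t * (c - d)))
      expand = solve-∀
      vanish : ∀ x → 0ℤ - x * 0ℤ ≡ 0ℤ
      vanish = solve-∀
    m₂-excess : m₂ - (ℓ + t * c) ≡ 0ℤ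
    m₂-excess = trans (negate ℓ m₂ t c) (cong -_ m₂-offset)
      where
      negate : ∀ ℓ m₂ t c → m₂ - (ℓ + t * c) ≡ - (t * c - (m₂ - ℓ))
      negate = solve-∀
    m₁-excess : m₁ - (ℓ - t * d) ≡ 0ℤ
    m₁-excess = begin
      m₁ - (ℓ - t * d)
        ≡⟨ regroup c d ℓ m₁ m₂ t ⟩
      ((m₁ + m₂) - (+ 2 * ℓ + t * (c - d))) + (t * c - (m₂ - ℓ))
        ≡⟨ cong₂ _+_ (i≡j⇒i-j≡0 size) m₂-offset ⟩
      0ℤ ∎
      where
      regroup : ∀ c d ℓ m₁ m₂ t → m₁ - (ℓ - t * d)
        ≡ ((m₁ + m₂) - (+ 2 * ℓ + t * (c - d))) + (t * c - (m₂ - ℓ))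
      regroup = solve-∀

  -- Two blocks cannot both be heavy: if M = ℓ + tc and M′ = ℓ + sc count
  -- points of a class of size e in two blocks with M + M′ ≤ e + ℓ, then
  -- e < 2tc + ℓ and e < 2sc + ℓ cannot hold together, as adding them gives
  -- 2e < 2(M + M′) − 2ℓ ≤ 2e.
  no-two-heavy : ∀ (e ℓ c t s M M′ : ℤ) → M ≡ ℓ + t * c → M′ ≡ ℓ + s * c →
    M + M′ ≤ e + ℓ → e < + 2 * t * c + ℓ → e < + 2 * s * c + ℓ → ⊥
  no-two-heavy e ℓ c t s _ _ refl refl pair-≤ heavy heavy′ = <-irrefl refl (begin-strict
    e + e                                       <⟨ +-mono-< heavy heavy′ ⟩
    (+ 2 * t * c + ℓ) + (+ 2 * s * c + ℓ)       ≡⟨ double ℓ t s c ⟩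
    (M + M′) + (M + M′) - (ℓ + ℓ)               ≤⟨ +-monoˡ-≤ (- (ℓ + ℓ)) (+-mono-≤ pair-≤ pair-≤) ⟩
    (e + ℓ) + (e + ℓ) - (ℓ + ℓ)                 ≡⟨ cancel e ℓ ⟩
    e + e                                       ∎)
    where
    open ≤-Reasoning
    M M′ : ℤ
    M = ℓ + t * c
    M′ = ℓ + s * c
    double : ∀ ℓ t s c → (+ 2 * t * c + ℓ) + (+ 2 * s * c + ℓ)
      ≡ ((ℓ + t * c) + (ℓ + s * c)) + ((ℓ + t * c) + (ℓ + s * c)) - (ℓ + ℓ)
    double = solve-∀
    cancel : ∀ e ℓ → (e + ℓ) + (e + ℓ) - (ℓ + ℓ) ≡ e + e
    cancel = solve-∀

open import Data.Fin using (Fin)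
import Data.Fin as Fin
open import Data.Fin.Subset using (∣_∣)
open import Data.Integer using (ℤ; +_; _+_; _-_; _*_; _<_; -_; +≤+)
open import Data.Integer.Properties using (pos-+; pos-*; +-injective; i-j≡0⇒i≡j)
open import Data.Integer.Tactic.RingSolver using (solve-∀)
import Data.Nat as ℕ
import Data.Nat.Properties as ℕ
open import Data.Nat.Coprimality using (Coprime; 0-coprimeTo-m⇒m≡1)
open import Data.Product using (_×_; _,_; proj₁; proj₂)
open import Data.Empty using (⊥-elim)
open import Function using (_∘_)
open import Relation.Nullary using (yes; no)
open import Relation.Binary.PropositionalEquality using (_≡_; _≢_; refl; sym; trans; cong; cong₂; module ≡-Reasoning)
open IntegerAlgebra using (class-sizes; no-two-heavy)

lowest-terms-distinct : ∀ {c d R₁ R₂} → Coprime c d → c ℕ.* R₂ ≡ d ℕ.* R₁ → R₂ ℕ.< R₁ → c ≢ d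
lowest-terms-distinct {ℕ.zero}  coprime _     _     refl = ℕ.1+n≢0 (sym (0-coprimeTo-m⇒m≡1 coprime))
lowest-terms-distinct {ℕ.suc k} {R₁ = R₁} {R₂ = R₂} _ ratio R₂<R₁ refl =
  ℕ.<⇒≢ R₂<R₁ (ℕ.*-cancelˡ-≡ R₂ R₁ (ℕ.suc k) ratio)

block-classes : ∀ {v ℓ r₁ r₂ c d} {D : Blocks v} → IsRyser v ℓ D →
  IsReplicationPair v D r₁ r₂ → LowestTerms r₁ r₂ c d →
  ∀ A t → + ∣ D A ∣ ≡ + 2 * + ℓ + t * (+ c - + d) →
  + Incidences.classCount D r₂ A ≡ + ℓ + t * + c × + Incidences.classCount D r₁ A ≡ + ℓ - t * + d
block-classes {v} {ℓ} {r₁} {r₂} {c} {d} {D} R (r₂<r₁ , r₁+r₂≡1+v , two) (coprime , ratio) A t size =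
  class-sizes (+ R₁) (+ R₂) (+ c) (+ d) (+ ℓ) (+ m₁) (+ m₂) t
    (λ R₁≡0 → ℕ.m<n⇒n≢0 R₂<R₁ (+-injective R₁≡0))
    (λ c-d≡0 → lowest-terms-distinct coprime ratio R₂<R₁ (+-injective (i-j≡0⇒i≡j (+ c) (+ d) c-d≡0)))
    (trans (sym (pos-* c R₂)) (trans (cong +_ ratio) (pos-* d R₁)))
    balanceℤ
    (trans (sym (pos-+ m₁ m₂)) (trans (cong +_ (sym (size-by-class A))) size))
  where
  open Incidences D
  open ReplicationPair R r₂<r₁ r₁+r₂≡1+v two
  R₁ R₂ m₁ m₂ : ℕ
  R₁ = r₁ ℕ.∸ 1
  R₂ = r₂ ℕ.∸ 1
  m₁ = classCount r₁ A
  m₂ = classCount r₂ A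
  R₂<R₁ : R₂ ℕ.< R₁
  R₂<R₁ = ℕ.∸-monoˡ-< r₂<r₁ (ℕ.n≢0⇒n>0 (r₂≢0 A))
  balanceℤ : + R₁ * + m₁ + + R₂ * + m₂ ≡ (+ R₁ + + R₂) * + ℓ
  balanceℤ = begin
    + R₁ * + m₁ + + R₂ * + m₂        ≡⟨ cong₂ _+_ (pos-* R₁ m₁) (pos-* R₂ m₂) ⟨
    + (R₁ ℕ.* m₁) + + (R₂ ℕ.* m₂)    ≡⟨ pos-+ (R₁ ℕ.* m₁) (R₂ ℕ.* m₂) ⟨
    + (R₁ ℕ.* m₁ ℕ.+ R₂ ℕ.* m₂)      ≡⟨ cong +_ (balance A) ⟩
    + ((R₁ ℕ.+ R₂) ℕ.* ℓ)            ≡⟨ pos-* (R₁ ℕ.+ R₂) ℓ ⟩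
    + (R₁ ℕ.+ R₂) * + ℓ              ≡⟨ cong (_* + ℓ) (pos-+ R₁ R₂) ⟩
    (+ R₁ + + R₂) * + ℓ              ∎
    where open ≡-Reasoning

large-block-class : ∀ {v ℓ r₁ r₂ c d} {D : Blocks v} → IsRyser v ℓ D →
  IsReplicationPair v D r₁ r₂ → LowestTerms r₁ r₂ c d →
  ∀ A t → + ∣ D A ∣ ≡ + 2 * + ℓ + t * (+ c - + d) → + Incidences.classCount D r₂ A ≡ + ℓ + t * + c
large-block-class R pair lowest A t size = proj₁ (block-classes R pair lowest A t size)

small-block-class : ∀ {v ℓ r₁ r₂ c d} {D : Blocks v} → IsRyser v ℓ D →
  IsReplicationPair v D r₁ r₂ → LowestTerms r₁ r₂ c d →
  ∀ B t → + ∣ D B ∣ ≡ + 2 * + ℓ - t * (+ c - + d) → + Incidences.classCount D r₁ B ≡ + ℓ + t * + d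
small-block-class {ℓ = ℓ} {c = c} {d} R pair lowest B t size =
  trans (proj₂ (block-classes R pair lowest B (- t) (trans size (negate-size (+ ℓ) t (+ c - + d)))))
        (negate-class (+ ℓ) t (+ d))
  where
  negate-size : ∀ ℓ t x → + 2 * ℓ - t * x ≡ + 2 * ℓ + (- t) * x
  negate-size = solve-∀
  negate-class : ∀ ℓ t x → ℓ - (- t) * x ≡ ℓ + t * x
  negate-class = solve-∀

-- Suppose blocks come with a parameter t
-- (a relation Sized X t) such that m_r(X) = ℓ + tk.  Then at most one
-- block X satisfies e_r < 2tk + ℓ: two distinct ones would contradict
-- m_r(A) + m_r(A′) ≤ e_r + ℓ.
heavy-unique : ∀ {v ℓ} {D : Blocks v} → IsRyser v ℓ D → ∀ r k (Sized : Fin v → ℤ → Set) →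
  (∀ X t → Sized X t → + Incidences.classCount D r X ≡ + ℓ + t * k) →
  (A : Fin v) (t : ℤ) → Sized A t → + numRep D r < + 2 * t * k + + ℓ →
  (A′ : Fin v) (s : ℤ) → Sized A′ s → + numRep D r < + 2 * s * k + + ℓ →
  A′ ≡ A
heavy-unique {ℓ = ℓ} {D} R r k _ class A t size heavy A′ s size′ heavy′ with A′ Fin.≟ A
... | yes A′≡A = A′≡A
... | no  A′≢A = ⊥-elim (no-two-heavy (+ numRep D r) (+ ℓ) k t s _ _
      (class A t size) (class A′ s size′)
      (+≤+ (Incidences.classCount-pair-≤ D R r A A′ (A′≢A ∘ sym))) heavy heavy′)

-- Theorem 4.1.  Both parts follow from heavy-unique with the class sizes
-- computed above.
theorem4p1 : (v ℓ r₁ r₂ c d : ℕ) (D : Blocks v) →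
    IsRyser v ℓ D → Type2 v D → IsReplicationPair v D r₁ r₂ →
    LowestTerms r₁ r₂ c d →
    -- (a)
    ((A : Fin v) (t : ℤ) →
      + ∣ D A ∣ ≡ + 2 * + ℓ + t * (+ c - + d) →
      + numRep D r₂ < + 2 * t * + c + + ℓ →
      (A′ : Fin v) (s : ℤ) →
      + ∣ D A′ ∣ ≡ + 2 * + ℓ + s * (+ c - + d) →
      + numRep D r₂ < + 2 * s * + c + + ℓ →
      A′ ≡ A)
    ×
    -- (b)
    ((B : Fin v) (t : ℤ) →
      + ∣ D B ∣ ≡ + 2 * + ℓ - t * (+ c - + d) →
      + numRep D r₁ < + 2 * t * + d + + ℓ →
      (B′ : Fin v) (s : ℤ) →
      + ∣ D B′ ∣ ≡ + 2 * + ℓ - s * (+ c - + d) →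
      + numRep D r₁ < + 2 * s * + d + + ℓ →
      B′ ≡ B)
theorem4p1 v ℓ r₁ r₂ c d D R _ pair lowest =
    heavy-unique R r₂ (+ c) (λ A t → + ∣ D A ∣ ≡ + 2 * + ℓ + t * (+ c - + d))
                 (large-block-class R pair lowest)
  , heavy-unique R r₁ (+ d) (λ B t → + ∣ D B ∣ ≡ + 2 * + ℓ - t * (+ c - + d))
                 (small-block-class R pair lowest)
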